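{- Let $M_1,M_2$ be binary matroids with $M=M_1\oplus M_2$ and $E(M_1)\cap E(M_2)=Z$, and let $X\subseteq E(M_2)\setminus Z$. Then every independent set of $M_1\oplus(M_2/X)$ is also independent in $(M_1\oplus M_2)/X$.
   Context: A cycle of a binary matroid is a disjoint union of circuits. For binary matroids $M_1,M_2$, $M_1\triangle M_2$ is the binary matroid on $E(M_1)\triangle E(M_2)$ whose cycles are exactly the sets $C_1\triangle C_2$ with $C_i$ a cycle of $M_i$. One writes $M=M_1\oplus M_2$ if $M=M_1\triangle M_2$ and either $E(M_1)\cap E(M_2)=\emptyset$, or $|E(M_1)\cap E(M_2)|=1$, or $E(M_1)\cap E(M_2)$ is a $3$-element set that is a circuit of both $M_1$ and $M_2$ (non-degeneracy conditions ignored). $/$ denotes contraction. -}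

module Defs where

open import Data.Nat using (ℕ)
open import Data.Bool using (_xor_)
open import Data.Vec using (zipWith)
open import Data.Product using (Σ; _×_)
open import Data.Sum using (_⊎_)
open import Data.Empty using (⊥)
open import Data.Fin.Subset using (Subset; _⊆_; _∩_; _─_; Nonempty; ∣_∣) renaming (⊥ to ∅)
open import Relation.Binary.PropositionalEquality using (_≡_)

-- All matroids live on subsets of a common finite universe Fin n.
-- A (pre)matroid is given by its ground set E and its set of cycles.
record CycleData (n : ℕ) : Set₁ where
  field
    E     : Subset n
    Cycle : Subset n → Set
open CycleData public

_△_ : ∀ {n} → Subset n → Subset n → Subset n
_△_ = zipWith _xor_

-- A binary matroid on ground set E is given by its cycle space:
-- a family of subsets of E containing ∅ and closed under symmetric difference.
record IsBinaryMatroid {n : ℕ} (M : CycleData n) : Set where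
  field
    cycle⊆E : ∀ C → Cycle M C → C ⊆ E M
    cycle-∅ : Cycle M ∅
    cycle-△ : ∀ C D → Cycle M C → Cycle M D → Cycle M (C △ D)

Circuit : ∀ {n} → CycleData n → Subset n → Set
Circuit M C = Cycle M C × Nonempty C
  × (∀ D → Cycle M D → Nonempty D → D ⊆ C → D ≡ C)

Independent : ∀ {n} → CycleData n → Subset n → Set
Independent M I = I ⊆ E M × (∀ C → Circuit M C → C ⊆ I → ⊥)

_△ᴹ_ : ∀ {n} → CycleData n → CycleData n → CycleData n
M₁ △ᴹ M₂ = record
  { E     = E M₁ △ E M₂
  ; Cycle = λ C → Σ _ λ C₁ → Σ _ λ C₂ →
              Cycle M₁ C₁ × Cycle M₂ C₂ × C ≡ C₁ △ C₂ × C ⊆ (E M₁ △ E M₂) }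

-- contraction M / X (for binary matroids): ground set E − X,
-- cycles are the sets C − X with C a cycle of M
_／_ : ∀ {n} → CycleData n → Subset n → CycleData n
M ／ X = record
  { E     = E M ─ X
  ; Cycle = λ C → Σ _ λ D → Cycle M D × C ≡ D ─ X }

-- the side conditions making M₁ △ M₂ a sum M₁ ⊕ M₂ (with Z = E₁ ∩ E₂)
IsSum : ∀ {n} → CycleData n → CycleData n → Set
IsSum M₁ M₂ =
  ∣ E M₁ ∩ E M₂ ∣ ≡ 0
  ⊎ ∣ E M₁ ∩ E M₂ ∣ ≡ 1
  ⊎ (∣ E M₁ ∩ E M₂ ∣ ≡ 3 × Circuit M₁ (E M₁ ∩ E M₂) × Circuit M₂ (E M₁ ∩ E M₂))

-- Because X avoids E(M₁), removing X commutes with adding a cycle of M₁: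
-- (C₁ △ C₂) ─ X = C₁ △ (C₂ ─ X). So M₁ △ (M₂ / X) and (M₁ △ M₂) / X have the
-- same ground set and the same cycles, hence the same independent sets.
module Submission where

open import Defs
open import Data.Nat using (ℕ)
open import Data.Bool using (_xor_)
open import Data.Fin using (Fin; zero)
open import Data.Fin.Subset using (Subset; _⊆_; _─_; _∩_; _∈_; _∉_; Empty; inside; outside)
open import Data.Fin.Subset.Properties
  using (_∈?_; drop-∷-Empty; p─q⊆p; x∈p∧x∉q⇒x∈p─q; p∩q⊆p; p∩q⊆q; x∈p∩q⁺)
open import Data.Vec using ([]; _∷_; here; there)
open import Data.Product using (_,_)
open import Function using (_∘_)
open import Relation.Nullary using (yes; no; contradiction)
open import Relation.Binary.PropositionalEquality using (_≡_; refl; sym; cong; subst; subst₂)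

private
  variable
    n : ℕ
    x : Fin n
    p q r : Subset n

x∈p─q⇒x∉q : x ∈ p ─ q → x ∉ q
x∈p─q⇒x∉q {p = _ ∷ _} {q = inside ∷ _} () here
x∈p─q⇒x∉q {p = _ ∷ _} {q = _ ∷ _} (there x∈p─q) (there x∈q) = x∈p─q⇒x∉q x∈p─q x∈q

x∉p∧x∈q⇒x∈p△q : x ∉ p → x ∈ q → x ∈ p △ q
x∉p∧x∈q⇒x∈p△q {p = outside ∷ _} _ here = here
x∉p∧x∈q⇒x∈p△q {p = inside ∷ _} x∉p here = contradiction here x∉p
x∉p∧x∈q⇒x∈p△q {p = _ ∷ _} {q = _ ∷ _} x∉p (there x∈q) =
  there (x∉p∧x∈q⇒x∈p△q (x∉p ∘ there) x∈q)

─-monoˡ : p ⊆ q → p ─ r ⊆ q ─ r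
─-monoˡ {p = p} {r = r} p⊆q x∈p─r =
  x∈p∧x∉q⇒x∈p─q (p⊆q (p─q⊆p p r x∈p─r)) (x∈p─q⇒x∉q x∈p─r)

r⊆q∧p─r⊆q─r⇒p⊆q : r ⊆ q → p ─ r ⊆ q ─ r → p ⊆ q
r⊆q∧p─r⊆q─r⇒p⊆q {r = r} {q = q} r⊆q p─r⊆q─r {x} x∈p with x ∈? r
... | yes x∈r = r⊆q x∈r
... | no  x∉r = p─q⊆p q r (p─r⊆q─r (x∈p∧x∉q⇒x∈p─q x∈p x∉r))

Empty-∩-monoˡ : p ⊆ q → Empty (q ∩ r) → Empty (p ∩ r)
Empty-∩-monoˡ {p = p} {r = r} p⊆q q∩r-empty (x , x∈p∩r) =
  q∩r-empty (x , x∈p∩q⁺ (p⊆q (p∩q⊆p p r x∈p∩r) , p∩q⊆q p r x∈p∩r))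

p△q─r≡p△[q─r] : ∀ (p q r : Subset n) → Empty (p ∩ r) → (p △ q) ─ r ≡ p △ (q ─ r)
p△q─r≡p△[q─r] []            []      []            _ = refl
p△q─r≡p△[q─r] (s ∷ p)       (t ∷ q) (outside ∷ r) e =
  cong ((s xor t) ∷_) (p△q─r≡p△[q─r] p q r (drop-∷-Empty e))
p△q─r≡p△[q─r] (outside ∷ p) (t ∷ q) (inside ∷ r)  e =
  cong (outside ∷_) (p△q─r≡p△[q─r] p q r (drop-∷-Empty e))
p△q─r≡p△[q─r] (inside ∷ p)  (t ∷ q) (inside ∷ r)  e = contradiction (zero , here) e

record _≈ᴹ_ (M N : CycleData n) : Set where
  field
    E-≡    : E M ≡ E N
    cycle⇒ : ∀ {C} → Cycle M C → Cycle N C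
    cycle⇐ : ∀ {C} → Cycle N C → Cycle M C
open _≈ᴹ_

≈ᴹ-sym : {M N : CycleData n} → M ≈ᴹ N → N ≈ᴹ M
≈ᴹ-sym M≈N = record { E-≡ = sym (E-≡ M≈N) ; cycle⇒ = cycle⇐ M≈N ; cycle⇐ = cycle⇒ M≈N }

Circuit-resp-≈ᴹ : {M N : CycleData n} → M ≈ᴹ N → ∀ {C} → Circuit M C → Circuit N C
Circuit-resp-≈ᴹ M≈N (cycle , nonempty , minimal) =
  cycle⇒ M≈N cycle , nonempty , λ D → minimal D ∘ cycle⇐ M≈N

Independent-resp-≈ᴹ : {M N : CycleData n} → M ≈ᴹ N → ∀ {I} → Independent M I → Independent N I
Independent-resp-≈ᴹ M≈N {I} (I⊆E , noCircuit) =
  subst (I ⊆_) (E-≡ M≈N) I⊆E , λ C → noCircuit C ∘ Circuit-resp-≈ᴹ (≈ᴹ-sym M≈N)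

△ᴹ-／-comm : ∀ (M₁ M₂ : CycleData n) {X} →
  (∀ C → Cycle M₁ C → C ⊆ E M₁) → X ⊆ E M₂ → Empty (E M₁ ∩ X) →
  (M₁ △ᴹ (M₂ ／ X)) ≈ᴹ ((M₁ △ᴹ M₂) ／ X)
△ᴹ-／-comm M₁ M₂ {X} cycle⊆E₁ X⊆E₂ E₁∩X-empty = record
  { E-≡ = ground-set ; cycle⇒ = cycle⇒′ ; cycle⇐ = cycle⇐′ }
  where
  E₁ = E M₁
  E₂ = E M₂

  remove-X : ∀ {C₁} C₂ → Cycle M₁ C₁ → (C₁ △ C₂) ─ X ≡ C₁ △ (C₂ ─ X)
  remove-X {C₁} C₂ c₁ =
    p△q─r≡p△[q─r] C₁ C₂ X (Empty-∩-monoˡ (cycle⊆E₁ C₁ c₁) E₁∩X-empty)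

  ground-set : E₁ △ (E₂ ─ X) ≡ (E₁ △ E₂) ─ X
  ground-set = sym (p△q─r≡p△[q─r] E₁ E₂ X E₁∩X-empty)

  X⊆E₁△E₂ : X ⊆ E₁ △ E₂
  X⊆E₁△E₂ x∈X = x∉p∧x∈q⇒x∈p△q (λ x∈E₁ → E₁∩X-empty (_ , x∈p∩q⁺ (x∈E₁ , x∈X))) (X⊆E₂ x∈X)

  cycle⇒′ : ∀ {C} → Cycle (M₁ △ᴹ (M₂ ／ X)) C → Cycle ((M₁ △ᴹ M₂) ／ X) C
  cycle⇒′ (C₁ , _ , c₁ , (C₂ , c₂ , refl) , refl , C⊆) =
    C₁ △ C₂ , (C₁ , C₂ , c₁ , c₂ , refl , C₁△C₂⊆) , sym (remove-X C₂ c₁)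
    where
    C₁△C₂⊆ : C₁ △ C₂ ⊆ E₁ △ E₂
    C₁△C₂⊆ = r⊆q∧p─r⊆q─r⇒p⊆q X⊆E₁△E₂
      (subst₂ _⊆_ (sym (remove-X C₂ c₁)) ground-set C⊆)

  cycle⇐′ : ∀ {C} → Cycle ((M₁ △ᴹ M₂) ／ X) C → Cycle (M₁ △ᴹ (M₂ ／ X)) C
  cycle⇐′ (_ , (C₁ , C₂ , c₁ , c₂ , refl , C₁△C₂⊆) , refl) =
    C₁ , C₂ ─ X , c₁ , (C₂ , c₂ , refl) , remove-X C₂ c₁ ,
    subst ((C₁ △ C₂) ─ X ⊆_) (sym ground-set) (─-monoˡ C₁△C₂⊆)

lemma17 : ∀ {n} (M₁ M₂ : CycleData n) →
    IsBinaryMatroid M₁ → IsBinaryMatroid M₂ →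
    IsSum M₁ M₂ →
    (X : Subset n) → X ⊆ (E M₂ ─ (E M₁ ∩ E M₂)) →
    ∀ I → Independent (M₁ △ᴹ (M₂ ／ X)) I → Independent ((M₁ △ᴹ M₂) ／ X) I
lemma17 M₁ M₂ M₁-binary _ _ X X⊆E₂─Z _ =
  Independent-resp-≈ᴹ (△ᴹ-／-comm M₁ M₂ (IsBinaryMatroid.cycle⊆E M₁-binary) X⊆E₂ E₁∩X-empty)
  where
  X⊆E₂ : X ⊆ E M₂
  X⊆E₂ = p─q⊆p _ _ ∘ X⊆E₂─Z

  E₁∩X-empty : Empty (E M₁ ∩ X)
  E₁∩X-empty (_ , x∈E₁∩X) = x∈p─q⇒x∉q (X⊆E₂─Z (p∩q⊆q _ _ x∈E₁∩X))
    (x∈p∩q⁺ (p∩q⊆p _ _ x∈E₁∩X , X⊆E₂ (p∩q⊆q _ _ x∈E₁∩X)))
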